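{- Let $f \in {\rm GL}(2, \mathbb{Q})$, and write its associated matrix $M_f$ in canonical form as $$ M_f = \frac{N}{D}\begin{pmatrix} m_1 & m_2 \\ m_3 & m_4 \end{pmatrix}, $$ where $m_1, m_2, m_3, m_4, N, D$ are integers with $N, D \geq 1$, $\gcd(N, D) = 1$ and $\gcd(m_1, m_2, m_3, m_4) = 1$. Let $L(f) = \{(u, v) \in \mathbb{Z}^2 : f(u, v) \in \mathbb{Z}^2\}$ be the lattice associated with $f$. Then $$ [\mathbb{Z}^2 : L(f)] = \frac{D^2}{\gcd(D, m_1m_4 - m_2m_3)}. $$ Finally, $[\mathbb{Z}^2 : L(f)]$ is an integral multiple of $\vert \det f \vert^{ -1}$.
   Context: A lattice means a subgroup of $\mathbb{Z}^2$ of rank two; its index is $[\mathbb{Z}^2 : \Lambda] = \vert \mathbb{Z}^2/\Lambda\vert$. Every matrix in ${\rm GL}(2, \mathbb{Q})$ can be uniquely written in the canonical form $\frac{N}{D}\begin{pmatrix} m_1 & m_2 \\ m_3 & m_4\end{pmatrix}$ with integers satisfying $N, D \geq 1$, $\gcd(N, D) = 1$, $\gcd(m_1, m_2, m_3, m_4) = 1$. -}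

module Defs where

open import Data.Nat as ℕ using (ℕ)
open import Data.Nat.GCD using (gcd)
import Data.Integer.GCD as ℤG
open import Data.Integer as ℤ using (ℤ; +_)
open import Data.Rational as ℚ using (ℚ; _/_)
open import Data.Fin using (Fin)
open import Data.Product using (_×_; _,_; ∃)
open import Relation.Binary.PropositionalEquality using (_≡_)

toℚ : ℤ → ℚ
toℚ z = z / 1

IsInt : ℚ → Set
IsInt q = ∃ λ (z : ℤ) → q ≡ toℚ z

ℤ² : Set
ℤ² = ℤ × ℤ

_-²_ : ℤ² → ℤ² → ℤ²
(a , b) -² (c , d) = (a ℤ.- c , b ℤ.- d)

-- A 2×2 rational matrix (a b ; c d), acting on column vectors:
-- f(u , v) = (a u + b v , c u + d v)
record Mat2ℚ : Set where
  constructor mat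
  field
    a b c d : ℚ

det : Mat2ℚ → ℚ
det (mat a b c d) = a ℚ.* d ℚ.- b ℚ.* c

InGL2 : Mat2ℚ → Set
InGL2 f = ℚ.NonZero (det f)

L : Mat2ℚ → ℤ² → Set
L (mat a b c d) (u , v) =
  IsInt (a ℚ.* toℚ u ℚ.+ b ℚ.* toℚ v) × IsInt (c ℚ.* toℚ u ℚ.+ d ℚ.* toℚ v)

-- [ℤ² : Λ] = k, i.e. the quotient group ℤ²/Λ has exactly k elements:
-- r : Fin k → ℤ² is a complete system of pairwise distinct coset representatives,
-- i.e. Fin k → ℤ²/Λ, i ↦ r i + Λ, is a bijection.
IndexIs : (ℤ² → Set) → ℕ → Set
IndexIs Λ k = ∃ λ (r : Fin k → ℤ²) →
  (∀ i j → Λ (r i -² r j) → i ≡ j) × (∀ p → ∃ λ i → Λ (p -² r i))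

IsCanonicalForm : Mat2ℚ → ℕ → ℕ → ℤ → ℤ → ℤ → ℤ → Set
IsCanonicalForm (mat a b c d) N D m₁ m₂ m₃ m₄ =
  (1 ℕ.≤ N) × (1 ℕ.≤ D) × (gcd N D ≡ 1) ×
  (ℤ.∣ ℤG.gcd (ℤG.gcd m₁ m₂) (ℤG.gcd m₃ m₄) ∣ ≡ 1) ×
  (toℚ (+ D) ℚ.* a ≡ toℚ (+ N ℤ.* m₁)) × (toℚ (+ D) ℚ.* b ≡ toℚ (+ N ℤ.* m₂)) ×
  (toℚ (+ D) ℚ.* c ≡ toℚ (+ N ℤ.* m₃)) × (toℚ (+ D) ℚ.* d ≡ toℚ (+ N ℤ.* m₄))

{-# OPTIONS --safe #-}
-- As gcd(N, D) = 1, f(u, v) is integral exactly when D divides both entries of M (u, v),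
-- M = (m₁ m₂ ; m₃ m₄); so L(f) is the lattice Λ_D(M) = { x : M x ≡ 0 (mod D) }.
-- Multiplying M on either side by a matrix of determinant 1 preserves det M and primitivity
-- and does not change the index of Λ_D(M): a row operation leaves Λ_D(M) unchanged, a column
-- operation moves it by an automorphism of ℤ². A Euclidean descent on the (1,1) entry, which
-- primitivity forces to end at 1, brings M to diag(1, δ), δ = det M, whose lattice
-- D ℤ × (D / gcd(D, δ)) ℤ has index D² / gcd(D, δ). Finally D² det f = N² δ, so that
-- k ∣det f∣ = N² ∣δ∣ / gcd(D, δ) is an integer.
module Submission where

open import Defs
open import Data.Nat as ℕ using (ℕ)
open import Data.Nat.GCD using (gcd)
open import Data.Integer as ℤ using (ℤ)
open import Data.Rational as ℚ using (ℚ)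
open import Data.Product using (_×_; _,_; ∃)
open import Relation.Binary.PropositionalEquality using (_≡_)

open import Data.Nat using (zero; suc; _<_; NonZero)
open import Data.Nat.Induction using (<-wellFounded)
open import Induction.WellFounded using (Acc; acc)
open import Data.Fin using (Fin; toℕ; fromℕ<; remQuot; combine)
import Data.Fin.Properties as FinP
import Data.Nat.Properties as ℕP
import Data.Nat.Divisibility as ℕD
open import Data.Nat.DivMod using (_/_; m/n*n≡m)
import Data.Nat.GCD as ℕG
import Data.Nat.Coprimality as ℕC
open import Data.Integer using (+_; _+_; _*_; _-_; -_; 0ℤ; 1ℤ; -1ℤ)
open import Data.Integer.DivMod using (_%ℕ_; _/ℕ_; n%ℕd<d; a≡a%ℕn+[a/ℕn]*n)
import Data.Integer.Properties as ℤP
open import Data.Integer.Divisibility.Signed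
  using (_∣_; divides; ∣ᵤ⇒∣; ∣⇒∣ᵤ; _∣?_; ∣-refl; ∣m∣n⇒∣m+n; ∣m∣n⇒∣m-n; ∣m+n∣m⇒∣n; ∣n⇒∣m*n; ∣m⇒∣m*n)
import Data.Integer.Coprimality as ℤC
import Data.Integer.GCD as ℤG
open import Data.Integer.Tactic.RingSolver using (solve-∀)
import Data.Rational.Properties as ℚP
import Data.Rational.Solver as ℚS
open import Data.Product using (proj₁; proj₂; ∃₂; uncurry)
open import Function using (_∘_; id)
open import Relation.Nullary using (¬_; Dec; yes; no; contradiction)
open import Data.Sum using (inj₁; inj₂)
open import Function.Bundles using (_⇔_; mk⇔; Equivalence)
open import Function.Construct.Composition using (_⇔-∘_)
open import Function.Construct.Symmetry using (⇔-sym)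
open import Data.Product.Function.NonDependent.Propositional using (_×-⇔_)
open import Relation.Binary.PropositionalEquality using (_≢_; refl; sym; trans; cong; cong₂; subst; subst₂; module ≡-Reasoning)

open Equivalence using (to; from)

-- Integers inside the rationals

toℚ≡mkℚ : ∀ z → toℚ z ≡ ℚ.mkℚ z 0 (ℕC.sym (ℕC.1-coprimeTo ℤ.∣ z ∣))
toℚ≡mkℚ z = ℚP.↥p/↧p≡p (ℚ.mkℚ z 0 _)

toℚ-injective : ∀ {x y} → toℚ x ≡ toℚ y → x ≡ y
toℚ-injective {x} {y} eq rewrite toℚ≡mkℚ x | toℚ≡mkℚ y = cong ℚ.↥_ eq

toℚ-homo-+ : ∀ x y → toℚ (x + y) ≡ toℚ x ℚ.+ toℚ y
toℚ-homo-+ x y rewrite toℚ≡mkℚ x | toℚ≡mkℚ y =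
  cong toℚ (cong₂ _+_ (sym (ℤP.*-identityʳ x)) (sym (ℤP.*-identityʳ y)))

toℚ-homo-* : ∀ x y → toℚ (x * y) ≡ toℚ x ℚ.* toℚ y
toℚ-homo-* x y rewrite toℚ≡mkℚ x | toℚ≡mkℚ y = refl

toℚ-homo‿- : ∀ x → toℚ (- x) ≡ ℚ.- toℚ x
toℚ-homo‿- (+ zero)     = refl
toℚ-homo‿- (+ suc n)    rewrite toℚ≡mkℚ (+ suc n) = refl
toℚ-homo‿- ℤ.-[1+ n ]   rewrite toℚ≡mkℚ ℤ.-[1+ n ] | toℚ≡mkℚ (+ suc n) = refl

toℚ-homo-∣∣ : ∀ z → ℚ.∣ toℚ z ∣ ≡ toℚ (+ ℤ.∣ z ∣)
toℚ-homo-∣∣ z rewrite toℚ≡mkℚ z | toℚ≡mkℚ (+ ℤ.∣ z ∣) = refl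

*-cancelˡ-≡ : ∀ r .{{_ : ℚ.NonZero r}} {p q} → r ℚ.* p ≡ r ℚ.* q → p ≡ q
*-cancelˡ-≡ r {p} {q} eq = trans (sym (1/r*[r*p]≡p p)) (trans (cong (ℚ.1/ r ℚ.*_) eq) (1/r*[r*p]≡p q))
  where
  open ≡-Reasoning
  1/r*[r*p]≡p : ∀ p → ℚ.1/ r ℚ.* (r ℚ.* p) ≡ p
  1/r*[r*p]≡p p = begin
    ℚ.1/ r ℚ.* (r ℚ.* p) ≡⟨ ℚP.*-assoc (ℚ.1/ r) r p ⟨
    ℚ.1/ r ℚ.* r ℚ.* p   ≡⟨ cong (ℚ._* p) (ℚP.*-inverseˡ r) ⟩
    ℚ.1ℚ ℚ.* p           ≡⟨ ℚP.*-identityˡ p ⟩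
    p                    ∎

toℚ-*-cancelˡ : ∀ n .{{_ : NonZero n}} {p q} → toℚ (+ n) ℚ.* p ≡ toℚ (+ n) ℚ.* q → p ≡ q
toℚ-*-cancelˡ n rewrite toℚ≡mkℚ (+ n) = *-cancelˡ-≡ (ℚ.mkℚ (+ n) 0 _)

toℚ-homo-sub : ∀ x y → toℚ (x - y) ≡ toℚ x ℚ.- toℚ y
toℚ-homo-sub x y = trans (toℚ-homo-+ x (- y)) (cong (toℚ x ℚ.+_) (toℚ-homo‿- y))

isInt⇔∣ : ∀ {D N w x} .{{_ : NonZero D}} → ℕC.Coprime D N →
          toℚ (+ D) ℚ.* x ≡ toℚ (+ N * w) → IsInt x ⇔ (+ D ∣ w)
isInt⇔∣ {D} {N} {w} {x} D⊥N Dx≡Nw = mk⇔ isInt⇒∣ ∣⇒isInt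
  where
  open ≡-Reasoning
  isInt⇒∣ : IsInt x → + D ∣ w
  isInt⇒∣ (z , x≡z) = ∣ᵤ⇒∣ (ℤC.coprime-divisor (+ D) (+ N) w D⊥N (∣⇒∣ᵤ (divides z Nw≡zD)))
    where
    Nw≡zD : + N * w ≡ z * + D
    Nw≡zD = toℚ-injective (begin
      toℚ (+ N * w)       ≡⟨ Dx≡Nw ⟨
      toℚ (+ D) ℚ.* x     ≡⟨ cong (toℚ (+ D) ℚ.*_) x≡z ⟩
      toℚ (+ D) ℚ.* toℚ z ≡⟨ toℚ-homo-* (+ D) z ⟨
      toℚ (+ D * z)       ≡⟨ cong toℚ (ℤP.*-comm (+ D) z) ⟩
      toℚ (z * + D)       ∎)
  ∣⇒isInt : + D ∣ w → IsInt x
  ∣⇒isInt (divides q w≡qD) = + N * q , toℚ-*-cancelˡ D (begin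
      toℚ (+ D) ℚ.* x             ≡⟨ Dx≡Nw ⟩
      toℚ (+ N * w)               ≡⟨ cong (λ w → toℚ (+ N * w)) w≡qD ⟩
      toℚ (+ N * (q * + D))       ≡⟨ cong toℚ (rearrange (+ N) q (+ D)) ⟩
      toℚ (+ D * (+ N * q))       ≡⟨ toℚ-homo-* (+ D) (+ N * q) ⟩
      toℚ (+ D) ℚ.* toℚ (+ N * q) ∎)
    where
    rearrange : ∀ n q d → n * (q * d) ≡ d * (n * q)
    rearrange = solve-∀

toℚ-scaled-row : ∀ {D N a b m m′} → toℚ (+ D) ℚ.* a ≡ toℚ (+ N * m) → toℚ (+ D) ℚ.* b ≡ toℚ (+ N * m′) →
                 ∀ u v → toℚ (+ D) ℚ.* (a ℚ.* toℚ u ℚ.+ b ℚ.* toℚ v) ≡ toℚ (+ N * (m * u + m′ * v))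
toℚ-scaled-row {D} {N} {a} {b} {m} {m′} Da Db u v = begin
  Dq ℚ.* (a ℚ.* toℚ u ℚ.+ b ℚ.* toℚ v)                 ≡⟨ ℚP.*-distribˡ-+ Dq (a ℚ.* toℚ u) (b ℚ.* toℚ v) ⟩
  Dq ℚ.* (a ℚ.* toℚ u) ℚ.+ Dq ℚ.* (b ℚ.* toℚ v)        ≡⟨ cong₂ ℚ._+_ (ℚP.*-assoc Dq a (toℚ u)) (ℚP.*-assoc Dq b (toℚ v)) ⟨
  Dq ℚ.* a ℚ.* toℚ u ℚ.+ Dq ℚ.* b ℚ.* toℚ v            ≡⟨ cong₂ (λ x y → x ℚ.* toℚ u ℚ.+ y ℚ.* toℚ v) Da Db ⟩
  toℚ (+ N * m) ℚ.* toℚ u ℚ.+ toℚ (+ N * m′) ℚ.* toℚ v ≡⟨ cong₂ ℚ._+_ (toℚ-homo-* (+ N * m) u) (toℚ-homo-* (+ N * m′) v) ⟨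
  toℚ (+ N * m * u) ℚ.+ toℚ (+ N * m′ * v)             ≡⟨ toℚ-homo-+ (+ N * m * u) (+ N * m′ * v) ⟨
  toℚ (+ N * m * u + + N * m′ * v)                     ≡⟨ cong toℚ (factor (+ N) m u m′ v) ⟩
  toℚ (+ N * (m * u + m′ * v))                         ∎
  where
  open ≡-Reasoning
  Dq = toℚ (+ D)
  factor : ∀ n m u m′ v → n * m * u + n * m′ * v ≡ n * (m * u + m′ * v)
  factor = solve-∀

toℚ-scaled-det : ∀ f N D m₁ m₂ m₃ m₄ → IsCanonicalForm f N D m₁ m₂ m₃ m₄ →
                 toℚ (+ (D ℕ.* D)) ℚ.* det f ≡ toℚ (+ (N ℕ.* N) * (m₁ * m₄ - m₂ * m₃))
toℚ-scaled-det (mat a b c d) N D m₁ m₂ m₃ m₄ (_ , _ , _ , _ , Da , Db , Dc , Dd) = begin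
  toℚ (+ (D ℕ.* D)) ℚ.* (a ℚ.* d ℚ.- b ℚ.* c)
    ≡⟨ cong (ℚ._* (a ℚ.* d ℚ.- b ℚ.* c)) (trans (cong toℚ (ℤP.pos-* D D)) (toℚ-homo-* (+ D) (+ D))) ⟩
  Dq ℚ.* Dq ℚ.* (a ℚ.* d ℚ.- b ℚ.* c)
    ≡⟨ ℚS.+-*-Solver.solve 5 (λ Dq a b c d → Dq :* Dq :* (a :* d :- b :* c) := (Dq :* a) :* (Dq :* d) :- (Dq :* b) :* (Dq :* c)) refl Dq a b c d ⟩
  (Dq ℚ.* a) ℚ.* (Dq ℚ.* d) ℚ.- (Dq ℚ.* b) ℚ.* (Dq ℚ.* c)
    ≡⟨ cong₂ ℚ._-_ (cong₂ ℚ._*_ Da Dd) (cong₂ ℚ._*_ Db Dc) ⟩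
  toℚ (+ N * m₁) ℚ.* toℚ (+ N * m₄) ℚ.- toℚ (+ N * m₂) ℚ.* toℚ (+ N * m₃)
    ≡⟨ cong₂ ℚ._-_ (toℚ-homo-* (+ N * m₁) (+ N * m₄)) (toℚ-homo-* (+ N * m₂) (+ N * m₃)) ⟨
  toℚ (+ N * m₁ * (+ N * m₄)) ℚ.- toℚ (+ N * m₂ * (+ N * m₃))
    ≡⟨ toℚ-homo-sub (+ N * m₁ * (+ N * m₄)) (+ N * m₂ * (+ N * m₃)) ⟨
  toℚ (+ N * m₁ * (+ N * m₄) - + N * m₂ * (+ N * m₃))
    ≡⟨ cong toℚ (trans (factor (+ N) m₁ m₂ m₃ m₄) (cong (_* (m₁ * m₄ - m₂ * m₃)) (sym (ℤP.pos-* N N)))) ⟩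
  toℚ (+ (N ℕ.* N) * (m₁ * m₄ - m₂ * m₃))
    ∎
  where
  open ≡-Reasoning
  open ℚS.+-*-Solver using (_:*_; _:-_; _:=_)
  Dq = toℚ (+ D)
  factor : ∀ n m₁ m₂ m₃ m₄ → n * m₁ * (n * m₄) - n * m₂ * (n * m₃) ≡ n * n * (m₁ * m₄ - m₂ * m₃)
  factor = solve-∀

k∣q∣-natural : ∀ {m k q z} .{{_ : NonZero m}} → toℚ (+ m) ℚ.* q ≡ toℚ z → m ℕD.∣ k ℕ.* ℤ.∣ z ∣ →
               ∃ λ n → toℚ (+ k) ℚ.* ℚ.∣ q ∣ ≡ toℚ (+ n)
k∣q∣-natural {m} {k} {q} {z} mq≡z (ℕD.divides n k∣z∣≡nm) = n , toℚ-*-cancelˡ m (begin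
  toℚ (+ m) ℚ.* (toℚ (+ k) ℚ.* ℚ.∣ q ∣) ≡⟨ ℚS.+-*-Solver.solve 3 (λ m k q → m :* (k :* q) := k :* (m :* q)) refl (toℚ (+ m)) (toℚ (+ k)) ℚ.∣ q ∣ ⟩
  toℚ (+ k) ℚ.* (toℚ (+ m) ℚ.* ℚ.∣ q ∣) ≡⟨ cong (toℚ (+ k) ℚ.*_) m∣q∣≡∣z∣ ⟩
  toℚ (+ k) ℚ.* toℚ (+ ℤ.∣ z ∣)         ≡⟨ toℚ-homo-* (+ k) (+ ℤ.∣ z ∣) ⟨
  toℚ (+ k * + ℤ.∣ z ∣)                 ≡⟨ cong toℚ (trans (sym (ℤP.pos-* k ℤ.∣ z ∣)) (cong +_ k∣z∣≡nm)) ⟩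
  toℚ (+ (n ℕ.* m))                     ≡⟨ cong toℚ (trans (ℤP.pos-* n m) (ℤP.*-comm (+ n) (+ m))) ⟩
  toℚ (+ m * + n)                       ≡⟨ toℚ-homo-* (+ m) (+ n) ⟩
  toℚ (+ m) ℚ.* toℚ (+ n)               ∎)
  where
  open ≡-Reasoning
  open ℚS.+-*-Solver using (_:*_; _:=_)
  m∣q∣≡∣z∣ : toℚ (+ m) ℚ.* ℚ.∣ q ∣ ≡ toℚ (+ ℤ.∣ z ∣)
  m∣q∣≡∣z∣ = begin
    toℚ (+ m) ℚ.* ℚ.∣ q ∣          ≡⟨ cong (ℚ._* ℚ.∣ q ∣) (toℚ-homo-∣∣ (+ m)) ⟨
    ℚ.∣ toℚ (+ m) ∣ ℚ.* ℚ.∣ q ∣    ≡⟨ ℚP.∣p*q∣≡∣p∣*∣q∣ (toℚ (+ m)) q ⟨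
    ℚ.∣ toℚ (+ m) ℚ.* q ∣          ≡⟨ cong ℚ.∣_∣ mq≡z ⟩
    ℚ.∣ toℚ z ∣                    ≡⟨ toℚ-homo-∣∣ z ⟩
    toℚ (+ ℤ.∣ z ∣)                ∎

-- Indices of subgroups of ℤ²

-²-cancelʳ : ∀ x y z → (x -² z) -² (y -² z) ≡ x -² y
-²-cancelʳ (x₁ , x₂) (y₁ , y₂) (z₁ , z₂) = cong₂ _,_ (cancel x₁ y₁ z₁) (cancel x₂ y₂ z₂)
  where
  cancel : ∀ x y z → (x - z) - (y - z) ≡ x - y
  cancel = solve-∀

IndexIs-resp : ∀ {Λ₁ Λ₂ : ℤ² → Set} {k} → (∀ x → Λ₁ x ⇔ Λ₂ x) → IndexIs Λ₁ k → IndexIs Λ₂ k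
IndexIs-resp Λ₁⇔Λ₂ (r , distinct , complete) =
  r , (λ i j → distinct i j ∘ from (Λ₁⇔Λ₂ _)) , (λ p → proj₁ (complete p) , to (Λ₁⇔Λ₂ _) (proj₂ (complete p)))

IndexIs-∘ : ∀ {Λ : ℤ² → Set} {k} (φ ψ : ℤ² → ℤ²) →
            (∀ x y → φ (x -² y) ≡ φ x -² φ y) → (∀ y → φ (ψ y) ≡ y) →
            IndexIs Λ k → IndexIs (Λ ∘ φ) k
IndexIs-∘ {Λ} φ ψ φ-hom φψ≡id (r , distinct , complete) = ψ ∘ r , distinct′ , complete′
  where
  φ-diff : ∀ x i → φ (x -² ψ (r i)) ≡ φ x -² r i
  φ-diff x i = trans (φ-hom x (ψ (r i))) (cong (φ x -²_) (φψ≡id (r i)))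
  distinct′ : ∀ i j → Λ (φ (ψ (r i) -² ψ (r j))) → i ≡ j
  distinct′ i j = distinct i j ∘ subst Λ (trans (φ-diff (ψ (r i)) j) (cong (_-² r j) (φψ≡id (r i))))
  complete′ : ∀ p → ∃ λ i → Λ (φ (p -² ψ (r i)))
  complete′ p = proj₁ (complete (φ p)) , subst Λ (sym (φ-diff p _)) (proj₂ (complete (φ p)))

IndexIs-unique : ∀ {Λ : ℤ² → Set} {k k′} → (∀ x y → Λ x → Λ y → Λ (x -² y)) →
                 IndexIs Λ k → IndexIs Λ k′ → k ≡ k′
IndexIs-unique {Λ} closed I I′ = ℕP.≤-antisym (index-≤ I I′) (index-≤ I′ I)
  where
  index-≤ : ∀ {k k′} → IndexIs Λ k → IndexIs Λ k′ → k ℕ.≤ k′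
  index-≤ (r , distinct , _) (r′ , _ , complete′) = FinP.injective⇒≤ class-injective
    where
    class = λ i → proj₁ (complete′ (r i))
    class-injective : ∀ {i j} → class i ≡ class j → i ≡ j
    class-injective {i} {j} eq = distinct i j (subst Λ (-²-cancelʳ (r i) (r j) (r′ (class j)))
      (closed _ _ (subst (λ l → Λ (r i -² r′ l)) eq (proj₂ (complete′ (r i)))) (proj₂ (complete′ (r j)))))

∣+m-+n∣≡∣m-n∣ : ∀ m n → ℤ.∣ + m - + n ∣ ≡ ℕ.∣ m - n ∣
∣+m-+n∣≡∣m-n∣ m n with ℕP.≤-total m n
... | inj₁ m≤n = begin
  ℤ.∣ + m - + n ∣   ≡⟨ cong ℤ.∣_∣ (ℤP.m-n≡m⊖n m n) ⟩
  ℤ.∣ m ℤ.⊖ n ∣     ≡⟨ ℤP.∣⊖∣-≤ m≤n ⟩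
  n ℕ.∸ m           ≡⟨ ℕP.m≤n⇒∣m-n∣≡n∸m m≤n ⟨
  ℕ.∣ m - n ∣       ∎
  where open ≡-Reasoning
... | inj₂ n≤m = begin
  ℤ.∣ + m - + n ∣   ≡⟨ cong ℤ.∣_∣ (ℤP.m-n≡m⊖n m n) ⟩
  ℤ.∣ m ℤ.⊖ n ∣     ≡⟨ ℤP.∣m⊖n∣≡∣n⊖m∣ m n ⟩
  ℤ.∣ n ℤ.⊖ m ∣     ≡⟨ ℤP.∣⊖∣-≤ n≤m ⟩
  m ℕ.∸ n           ≡⟨ ℕP.m≤n⇒∣m-n∣≡n∸m n≤m ⟨
  ℕ.∣ n - m ∣       ≡⟨ ℕP.∣-∣-comm n m ⟩
  ℕ.∣ m - n ∣       ∎
  where open ≡-Reasoning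

residue-injective : ∀ {D i j} → i < D → j < D → + D ∣ + i - + j → i ≡ j
residue-injective {D} {i} {j} i<D j<D D∣i-j =
  ℕP.∣m-n∣≡0⇒m≡n (multiple<⇒≡0 (subst (D ℕD.∣_) (∣+m-+n∣≡∣m-n∣ i j) (∣⇒∣ᵤ D∣i-j))
                                (ℕP.≤-<-trans (ℕP.∣m-n∣≤m⊔n i j) (ℕP.⊔-lub i<D j<D)))
  where
  multiple<⇒≡0 : ∀ {x} → D ℕD.∣ x → x < D → x ≡ 0
  multiple<⇒≡0 {zero}  _   _   = refl
  multiple<⇒≡0 {suc _} D∣x x<D = contradiction D∣x (ℕD.>⇒∤ x<D)

residue : ∀ D .{{_ : NonZero D}} → ℤ → Fin D
residue D p = fromℕ< (n%ℕd<d p D)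

∣-residue : ∀ D .{{_ : NonZero D}} p → + D ∣ p - + toℕ (residue D p)
∣-residue D p = divides (p /ℕ D) (begin
  p - + toℕ (residue D p)                     ≡⟨ cong (λ r → p - + r) (FinP.toℕ-fromℕ< _) ⟩
  p - + (p %ℕ D)                              ≡⟨ cong (_- + (p %ℕ D)) (a≡a%ℕn+[a/ℕn]*n p D) ⟩
  + (p %ℕ D) + (p /ℕ D) * + D - + (p %ℕ D)    ≡⟨ cancel (+ (p %ℕ D)) ((p /ℕ D) * + D) ⟩
  (p /ℕ D) * + D                              ∎)
  where
  open ≡-Reasoning
  cancel : ∀ r s → r + s - r ≡ s
  cancel = solve-∀

IndexIs-∣×∣ : ∀ D E .{{_ : NonZero D}} .{{_ : NonZero E}} →
              IndexIs (λ (u , v) → + D ∣ u × + E ∣ v) (D ℕ.* E)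
IndexIs-∣×∣ D E = r , distinct , complete
  where
  open ≡-Reasoning
  point : Fin D × Fin E → ℤ²
  point (i , j) = + toℕ i , + toℕ j
  r : Fin (D ℕ.* E) → ℤ²
  r = point ∘ remQuot {D} E
  distinct : ∀ k l → + D ∣ proj₁ (r k -² r l) × + E ∣ proj₂ (r k -² r l) → k ≡ l
  distinct k l (D∣ , E∣) = begin
    k                                  ≡⟨ FinP.combine-remQuot {D} E k ⟨
    uncurry combine (remQuot {D} E k)  ≡⟨ cong (uncurry combine) (cong₂ _,_ (same D∣) (same E∣)) ⟩
    uncurry combine (remQuot {D} E l)  ≡⟨ FinP.combine-remQuot {D} E l ⟩
    l                                  ∎
    where
    same : ∀ {n} {i j : Fin n} → + n ∣ + toℕ i - + toℕ j → i ≡ j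
    same = FinP.toℕ-injective ∘ residue-injective (FinP.toℕ<n _) (FinP.toℕ<n _)
  complete : ∀ p → ∃ λ k → + D ∣ proj₁ (p -² r k) × + E ∣ proj₂ (p -² r k)
  complete (u , v) = combine (residue D u) (residue E v) ,
    subst (λ x → + D ∣ u - proj₁ x × + E ∣ v - proj₂ x)
          (sym (cong point (FinP.remQuot-combine (residue D u) (residue E v))))
          (∣-residue D u , ∣-residue E v)

-- Integer matrices acting on ℤ²

record Mat2ℤ : Set where
  constructor matℤ
  field a b c d : ℤ

matℤ-cong : ∀ {a a′ b b′ c c′ d d′} → a ≡ a′ → b ≡ b′ → c ≡ c′ → d ≡ d′ → matℤ a b c d ≡ matℤ a′ b′ c′ d′
matℤ-cong refl refl refl refl = refl

detℤ : Mat2ℤ → ℤ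
detℤ (matℤ a b c d) = a * d - b * c

_·_ : Mat2ℤ → Mat2ℤ → Mat2ℤ
matℤ a b c d · matℤ p q r s = matℤ (a * p + b * r) (a * q + b * s) (c * p + d * r) (c * q + d * s)

_⊛_ : Mat2ℤ → ℤ² → ℤ²
matℤ a b c d ⊛ (x , y) = a * x + b * y , c * x + d * y

adj : Mat2ℤ → Mat2ℤ
adj (matℤ a b c d) = matℤ d (- b) (- c) a

transpose : Mat2ℤ → Mat2ℤ
transpose (matℤ a b c d) = matℤ a c b d

row₁ : Mat2ℤ → ℤ²
row₁ (matℤ a b _ _) = a , b

·-⊛ : ∀ A B x → (A · B) ⊛ x ≡ A ⊛ (B ⊛ x)
·-⊛ (matℤ a b c d) (matℤ p q r s) (x , y) = cong₂ _,_ (assoc a b p q r s x y) (assoc c d p q r s x y)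
  where
  assoc : ∀ a b p q r s x y → (a * p + b * r) * x + (a * q + b * s) * y ≡ a * (p * x + q * y) + b * (r * x + s * y)
  assoc = solve-∀

⊛-linear : ∀ A x y → A ⊛ (x -² y) ≡ (A ⊛ x) -² (A ⊛ y)
⊛-linear (matℤ a b c d) (x₁ , x₂) (y₁ , y₂) = cong₂ _,_ (linear a b x₁ x₂ y₁ y₂) (linear c d x₁ x₂ y₁ y₂)
  where
  linear : ∀ a b x₁ x₂ y₁ y₂ → a * (x₁ - y₁) + b * (x₂ - y₂) ≡ (a * x₁ + b * x₂) - (a * y₁ + b * y₂)
  linear = solve-∀

adj-⊛-inverseˡ : ∀ A → detℤ A ≡ 1ℤ → ∀ x → adj A ⊛ (A ⊛ x) ≡ x
adj-⊛-inverseˡ (matℤ a b c d) det≡1 (x , y) = cong₂ _,_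
  (trans (first a b c d x y) (scale-by-det x)) (trans (second a b c d x y) (scale-by-det y))
  where
  first : ∀ a b c d x y → d * (a * x + b * y) + - b * (c * x + d * y) ≡ (a * d - b * c) * x
  first = solve-∀
  second : ∀ a b c d x y → - c * (a * x + b * y) + a * (c * x + d * y) ≡ (a * d - b * c) * y
  second = solve-∀
  scale-by-det : ∀ x → (a * d - b * c) * x ≡ x
  scale-by-det x = trans (cong (_* x) det≡1) (ℤP.*-identityˡ x)

adj-⊛-inverseʳ : ∀ A → detℤ A ≡ 1ℤ → ∀ x → A ⊛ (adj A ⊛ x) ≡ x
adj-⊛-inverseʳ (matℤ a b c d) det≡1 (x , y) = cong₂ _,_
  (trans (first a b c d x y) (scale-by-det x)) (trans (second a b c d x y) (scale-by-det y))
  where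
  first : ∀ a b c d x y → a * (d * x + - b * y) + b * (- c * x + a * y) ≡ (a * d - b * c) * x
  first = solve-∀
  second : ∀ a b c d x y → c * (d * x + - b * y) + d * (- c * x + a * y) ≡ (a * d - b * c) * y
  second = solve-∀
  scale-by-det : ∀ x → (a * d - b * c) * x ≡ x
  scale-by-det x = trans (cong (_* x) det≡1) (ℤP.*-identityˡ x)

detℤ-· : ∀ A B → detℤ (A · B) ≡ detℤ A * detℤ B
detℤ-· (matℤ a b c d) (matℤ p q r s) = multiplicative a b c d p q r s
  where
  multiplicative : ∀ a b c d p q r s →
    (a * p + b * r) * (c * q + d * s) - (a * q + b * s) * (c * p + d * r) ≡ (a * d - b * c) * (p * s - q * r)
  multiplicative = solve-∀

detℤ-transpose : ∀ A → detℤ (transpose A) ≡ detℤ A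
detℤ-transpose (matℤ a b c d) = cong (λ bc → a * d - bc) (ℤP.*-comm c b)

row₁-·-transpose : ∀ M U → row₁ (M · transpose U) ≡ U ⊛ row₁ M
row₁-·-transpose (matℤ a b _ _) (matℤ p q r s) = cong₂ _,_ (swap a b p q) (swap a b r s)
  where
  swap : ∀ a b p q → a * p + b * q ≡ p * a + q * b
  swap = solve-∀

infix 4 _∣ᵛ_ _∣ᴹ_

_∣ᵛ_ : ℤ → ℤ² → Set
z ∣ᵛ (p , q) = z ∣ p × z ∣ q

∣ᵛ-sub : ∀ {z x y} → z ∣ᵛ x → z ∣ᵛ y → z ∣ᵛ (x -² y)
∣ᵛ-sub (z∣x₁ , z∣x₂) (z∣y₁ , z∣y₂) = ∣m∣n⇒∣m-n z∣x₁ z∣y₁ , ∣m∣n⇒∣m-n z∣x₂ z∣y₂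

∣ᵛ-⊛ : ∀ {z} A {y} → z ∣ᵛ y → z ∣ᵛ (A ⊛ y)
∣ᵛ-⊛ (matℤ a b c d) (z∣y₁ , z∣y₂) =
  ∣m∣n⇒∣m+n (∣n⇒∣m*n a z∣y₁) (∣n⇒∣m*n b z∣y₂) , ∣m∣n⇒∣m+n (∣n⇒∣m*n c z∣y₁) (∣n⇒∣m*n d z∣y₂)

∣ᵛ-⊛⁻¹ : ∀ {z} A {y} → detℤ A ≡ 1ℤ → z ∣ᵛ (A ⊛ y) → z ∣ᵛ y
∣ᵛ-⊛⁻¹ {z} A {y} det≡1 = subst (z ∣ᵛ_) (adj-⊛-inverseˡ A det≡1 y) ∘ ∣ᵛ-⊛ (adj A)

KerMod : Mat2ℤ → ℕ → ℤ² → Set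
KerMod M D x = + D ∣ᵛ (M ⊛ x)

KerMod-closed : ∀ M D x y → KerMod M D x → KerMod M D y → KerMod M D (x -² y)
KerMod-closed M D x y Mx My = subst (+ D ∣ᵛ_) (sym (⊛-linear M x y)) (∣ᵛ-sub Mx My)

-- z ∣ᴹ M says that z divides every entry of M, phrased as M ℤ² ⊆ z ℤ².
_∣ᴹ_ : ℤ → Mat2ℤ → Set
z ∣ᴹ M = ∀ x → z ∣ᵛ (M ⊛ x)

∣-entries⇒∣ᴹ : ∀ {z a b c d} → z ∣ a → z ∣ b → z ∣ c → z ∣ d → z ∣ᴹ matℤ a b c d
∣-entries⇒∣ᴹ z∣a z∣b z∣c z∣d (x , y) =
  ∣m∣n⇒∣m+n (∣m⇒∣m*n x z∣a) (∣m⇒∣m*n y z∣b) , ∣m∣n⇒∣m+n (∣m⇒∣m*n x z∣c) (∣m⇒∣m*n y z∣d)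

∣ᴹ⇒∣-entries : ∀ {z a b c d} → z ∣ᴹ matℤ a b c d → z ∣ a × z ∣ b × z ∣ c × z ∣ d
∣ᴹ⇒∣-entries {z} {a} {b} {c} {d} z∣M =
  subst (z ∣_) (first a b) (proj₁ (z∣M (1ℤ , 0ℤ))) , subst (z ∣_) (second a b) (proj₁ (z∣M (0ℤ , 1ℤ))) ,
  subst (z ∣_) (first c d) (proj₂ (z∣M (1ℤ , 0ℤ))) , subst (z ∣_) (second c d) (proj₂ (z∣M (0ℤ , 1ℤ)))
  where
  first : ∀ p q → p * 1ℤ + q * 0ℤ ≡ p
  first = solve-∀
  second : ∀ p q → p * 0ℤ + q * 1ℤ ≡ q
  second = solve-∀

Primitive : Mat2ℤ → Set
Primitive M = ∀ z → z ∣ᴹ M → z ∣ 1ℤ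

IndexFormula : Mat2ℤ → Set
IndexFormula M = ∀ D .{{_ : NonZero D}} →
  ∃ λ k → IndexIs (KerMod M D) k × k ℕ.* gcd D ℤ.∣ detℤ M ∣ ≡ D ℕ.* D

record _⇝_ (M M′ : Mat2ℤ) : Set where
  field
    preserves-primitive : Primitive M → Primitive M′
    reflects-indexFormula : IndexFormula M′ → IndexFormula M

open _⇝_

⇝-reflexive : ∀ {M M′} → M ≡ M′ → M ⇝ M′
⇝-reflexive refl = record { preserves-primitive = id ; reflects-indexFormula = id }

⇝-trans : ∀ {M M′ M″} → M ⇝ M′ → M′ ⇝ M″ → M ⇝ M″
⇝-trans M⇝M′ M′⇝M″ = record
  { preserves-primitive = preserves-primitive M′⇝M″ ∘ preserves-primitive M⇝M′
  ; reflects-indexFormula = reflects-indexFormula M⇝M′ ∘ reflects-indexFormula M′⇝M″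
  }

indexFormula-transfer : ∀ {M M′} → detℤ M′ ≡ detℤ M →
                        (∀ D {k} → IndexIs (KerMod M′ D) k → IndexIs (KerMod M D) k) →
                        IndexFormula M′ → IndexFormula M
indexFormula-transfer det≡ transfer formula D =
  let k , index , k-formula = formula D
  in k , transfer D index , subst (λ δ → k ℕ.* gcd D ℤ.∣ δ ∣ ≡ D ℕ.* D) det≡ k-formula

⇝-row : ∀ U M → detℤ U ≡ 1ℤ → M ⇝ (U · M)
⇝-row U M det≡1 = record
  { preserves-primitive = λ prim z z∣UM → prim z λ x → ∣ᵛ-⊛⁻¹ U det≡1 (subst (z ∣ᵛ_) (·-⊛ U M x) (z∣UM x))
  ; reflects-indexFormula = indexFormula-transfer {M} {U · M}
      (trans (detℤ-· U M) (trans (cong (_* detℤ M) det≡1) (ℤP.*-identityˡ (detℤ M))))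
      (λ D → IndexIs-resp λ x → mk⇔ (∣ᵛ-⊛⁻¹ U det≡1 ∘ subst (+ D ∣ᵛ_) (·-⊛ U M x))
                                    (subst (+ D ∣ᵛ_) (sym (·-⊛ U M x)) ∘ ∣ᵛ-⊛ U))
  }

⇝-col : ∀ M V → detℤ V ≡ 1ℤ → M ⇝ (M · V)
⇝-col M V det≡1 = record
  { preserves-primitive = λ prim z z∣MV → prim z λ x → subst (z ∣ᵛ_) (undo x) (z∣MV (adj V ⊛ x))
  ; reflects-indexFormula = indexFormula-transfer {M} {M · V}
      (trans (detℤ-· M V) (trans (cong (detℤ M *_) det≡1) (ℤP.*-identityʳ (detℤ M))))
      (λ D → IndexIs-resp (λ x → mk⇔ (subst (+ D ∣ᵛ_) (undo x)) (subst (+ D ∣ᵛ_) (sym (undo x))))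
           ∘ IndexIs-∘ {KerMod (M · V) D} (adj V ⊛_) (V ⊛_) (⊛-linear (adj V)) (adj-⊛-inverseˡ V det≡1))
  }
  where
  undo : ∀ x → (M · V) ⊛ (adj V ⊛ x) ≡ M ⊛ x
  undo x = trans (·-⊛ M V (adj V ⊛ x)) (cong (M ⊛_) (adj-⊛-inverseʳ V det≡1 x))

-- Euclidean reduction by unimodular row and column operations

pos-lift : ∀ g y n x m → g ℕ.+ y ℕ.* n ≡ x ℕ.* m → + g + + y * + n ≡ + x * + m
pos-lift g y n x m eq = begin
  + g + + y * + n     ≡⟨ cong (λ a → + g + a) (ℤP.pos-* y n) ⟨
  + g + + (y ℕ.* n)   ≡⟨ ℤP.pos-+ g (y ℕ.* n) ⟨
  + (g ℕ.+ y ℕ.* n)   ≡⟨ cong +_ eq ⟩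
  + (x ℕ.* m)         ≡⟨ ℤP.pos-* x m ⟩
  + x * + m           ∎
  where open ≡-Reasoning

bézout-+ : ∀ m n → ∃₂ λ s t → s * + m + t * + n ≡ + gcd m n
bézout-+ m n with ℕG.Bézout.identity (ℕG.gcd-GCD m n)
... | ℕG.Bézout.+- x y eq = + x , - + y ,
  trans (cong (_+ - + y * + n) (sym (pos-lift (gcd m n) y n x m eq))) (cancel (+ gcd m n) (+ y) (+ n))
  where
  cancel : ∀ g y n → g + y * n + - y * n ≡ g
  cancel = solve-∀
... | ℕG.Bézout.-+ x y eq = - + x , + y ,
  trans (cong (λ a → - + x * + m + a) (sym (pos-lift (gcd m n) x m y n eq))) (cancel (+ gcd m n) (+ x) (+ m))
  where
  cancel : ∀ g x m → - x * m + (g + x * m) ≡ g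
  cancel = solve-∀

unit-multiple-∣∣ : ∀ z → ∃ λ σ → σ * z ≡ + ℤ.∣ z ∣
unit-multiple-∣∣ z with ℤP.+∣i∣≡i⊎+∣i∣≡-i z
... | inj₁ ∣z∣≡z  = 1ℤ , trans (ℤP.*-identityˡ z) (sym ∣z∣≡z)
... | inj₂ ∣z∣≡-z = -1ℤ , trans (ℤP.-1*i≡-i z) (sym ∣z∣≡-z)

bézout : ∀ x y → ∃₂ λ s t → s * x + t * y ≡ + gcd ℤ.∣ x ∣ ℤ.∣ y ∣
bézout x y with bézout-+ ℤ.∣ x ∣ ℤ.∣ y ∣ | unit-multiple-∣∣ x | unit-multiple-∣∣ y
... | s , t , bez | σ , σx≡∣x∣ | τ , τy≡∣y∣ = s * σ , t * τ , (begin
  s * σ * x + t * τ * y          ≡⟨ reassoc s σ x t τ y ⟩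
  s * (σ * x) + t * (τ * y)      ≡⟨ cong₂ (λ p q → s * p + t * q) σx≡∣x∣ τy≡∣y∣ ⟩
  s * + ℤ.∣ x ∣ + t * + ℤ.∣ y ∣  ≡⟨ bez ⟩
  + gcd ℤ.∣ x ∣ ℤ.∣ y ∣          ∎)
  where
  open ≡-Reasoning
  reassoc : ∀ s σ x t τ y → s * σ * x + t * τ * y ≡ s * (σ * x) + t * (τ * y)
  reassoc = solve-∀

unimodular-to-gcd : ∀ x y → ∃ λ U → detℤ U ≡ 1ℤ × U ⊛ (x , y) ≡ (+ gcd ℤ.∣ x ∣ ℤ.∣ y ∣ , 0ℤ)
unimodular-to-gcd x y with gcd ℤ.∣ x ∣ ℤ.∣ y ∣ ℕ.≟ 0
... | yes g≡0 = matℤ 1ℤ 0ℤ 0ℤ 1ℤ , refl , cong₂ _,_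
  (trans (first x y) (trans x≡0 (cong +_ (sym g≡0)))) (trans (second x y) y≡0)
  where
  x≡0 = ℤP.∣i∣≡0⇒i≡0 (ℕG.gcd[m,n]≡0⇒m≡0 g≡0)
  y≡0 = ℤP.∣i∣≡0⇒i≡0 (ℕG.gcd[m,n]≡0⇒n≡0 ℤ.∣ x ∣ g≡0)
  first : ∀ x y → 1ℤ * x + 0ℤ * y ≡ x
  first = solve-∀
  second : ∀ x y → 0ℤ * x + 1ℤ * y ≡ y
  second = solve-∀
... | no g≢0 with bézout x y | ∣ᵤ⇒∣ (ℤG.gcd[i,j]∣i x y) | ∣ᵤ⇒∣ (ℤG.gcd[i,j]∣j x y)
...   | s , t , bez | divides α x≡αg | divides β y≡βg = matℤ s t (- β) α , det≡1 , cong₂ _,_ bez lower≡0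
  where
  open ≡-Reasoning
  g = gcd ℤ.∣ x ∣ ℤ.∣ y ∣
  instance _ = ℕ.≢-nonZero g≢0
  lower≡0 : - β * x + α * y ≡ 0ℤ
  lower≡0 = trans (cong₂ (λ p q → - β * p + α * q) x≡αg y≡βg) (annihilate α β (+ g))
    where
    annihilate : ∀ α β g → - β * (α * g) + α * (β * g) ≡ 0ℤ
    annihilate = solve-∀
  det≡1 : s * α - t * - β ≡ 1ℤ
  det≡1 = ℤP.*-cancelʳ-≡ _ 1ℤ (+ g) (begin
    (s * α - t * - β) * + g        ≡⟨ expand s t α β (+ g) ⟩
    s * (α * + g) + t * (β * + g)  ≡⟨ cong₂ (λ p q → s * p + t * q) x≡αg y≡βg ⟨
    s * x + t * y                  ≡⟨ bez ⟩
    + g                            ≡⟨ ℤP.*-identityˡ (+ g) ⟨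
    1ℤ * + g                       ∎)
    where
    expand : ∀ s t α β g → (s * α - t * - β) * g ≡ s * (α * g) + t * (β * g)
    expand = solve-∀

triangular : ℕ → ℤ → ℤ → Mat2ℤ
triangular h b e = matℤ (+ h) b 0ℤ e

column-reduce : ∀ M → ∃₂ λ b e → M ⇝ triangular (gcd ℤ.∣ Mat2ℤ.a M ∣ ℤ.∣ Mat2ℤ.c M ∣) b e
column-reduce M with unimodular-to-gcd (Mat2ℤ.a M) (Mat2ℤ.c M)
... | U , det≡1 , U⊛col≡ = Mat2ℤ.b (U · M) , Mat2ℤ.d (U · M) ,
  ⇝-trans (⇝-row U M det≡1) (⇝-reflexive (matℤ-cong (cong proj₁ U⊛col≡) refl (cong proj₂ U⊛col≡) refl))

row-reduce : ∀ M → ∃₂ λ c e → M ⇝ matℤ (+ gcd ℤ.∣ Mat2ℤ.a M ∣ ℤ.∣ Mat2ℤ.b M ∣) 0ℤ c e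
row-reduce M with unimodular-to-gcd (Mat2ℤ.a M) (Mat2ℤ.b M)
... | U , det≡1 , U⊛row≡ = Mat2ℤ.c (M · transpose U) , Mat2ℤ.d (M · transpose U) ,
  ⇝-trans (⇝-col M (transpose U) (trans (detℤ-transpose U) det≡1))
          (⇝-reflexive (matℤ-cong (cong proj₁ row≡) (cong proj₂ row≡) refl refl))
  where
  row≡ = trans (row₁-·-transpose M U) U⊛row≡

nondivisible-upper : ∀ {h b e} → h ≢ 1 → Primitive (triangular h b e) →
                     ∃ λ b′ → triangular h b e ⇝ triangular h b′ e × ¬ (+ h ∣ b′)
nondivisible-upper {h} {b} {e} h≢1 prim with + h ∣? b | + h ∣? (b + e)
... | no h∤b    | _          = b , ⇝-reflexive refl , h∤b
... | yes _     | no h∤b+e   = b + e , ⇝-trans (⇝-row shear (triangular h b e) refl) (⇝-reflexive sheared) , h∤b+e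
  where
  shear = matℤ 1ℤ 1ℤ 0ℤ 1ℤ
  pivot : ∀ h → 1ℤ * h + 1ℤ * 0ℤ ≡ h
  pivot = solve-∀
  upper : ∀ b e → 1ℤ * b + 1ℤ * e ≡ b + e
  upper = solve-∀
  lower : ∀ b e → 0ℤ * b + 1ℤ * e ≡ e
  lower = solve-∀
  sheared : shear · triangular h b e ≡ triangular h (b + e) e
  sheared = matℤ-cong (pivot (+ h)) (upper b e) refl (lower b e)
... | yes h∣b   | yes h∣b+e  = contradiction (ℕD.∣1⇒≡1 (∣⇒∣ᵤ (prim (+ h) h∣T))) h≢1
  where
  h∣T : + h ∣ᴹ triangular h b e
  h∣T = ∣-entries⇒∣ᴹ ∣-refl h∣b (divides 0ℤ refl) (∣m+n∣m⇒∣n h∣b+e h∣b)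

gcd-shrinks : ∀ {h R} → ¬ (+ h ∣ R) → ∀ x →
              NonZero (gcd (gcd h ℤ.∣ R ∣) ℤ.∣ x ∣) × (NonZero h → gcd (gcd h ℤ.∣ R ∣) ℤ.∣ x ∣ < h)
gcd-shrinks {h} {R} h∤R x = ℕ.≢-nonZero (ℕG.gcd[m,n]≢0 g ℤ.∣ x ∣ (inj₁ g≢0)) , g′<h
  where
  g = gcd h ℤ.∣ R ∣
  g≢0 : g ≢ 0
  g≢0 g≡0 = h∤R (subst (+ h ∣_) (sym (ℤP.∣i∣≡0⇒i≡0 (ℕG.gcd[m,n]≡0⇒n≡0 h g≡0))) (divides 0ℤ refl))
  g≢h : g ≢ h
  g≢h g≡h = h∤R (∣ᵤ⇒∣ (subst (ℕD._∣ ℤ.∣ R ∣) g≡h (ℕG.gcd[m,n]∣n h ℤ.∣ R ∣)))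
  g′<h : NonZero h → gcd g ℤ.∣ x ∣ < h
  g′<h h≢0 = ℕP.≤-<-trans (ℕD.∣⇒≤ {{ℕ.≢-nonZero g≢0}} (ℕG.gcd[m,n]∣m g ℤ.∣ x ∣))
                          (ℕP.≤∧≢⇒< (ℕD.∣⇒≤ {{h≢0}} (ℕG.gcd[m,n]∣m h ℤ.∣ R ∣)) g≢h)

Shrinks : ℕ → ℤ → ℤ → Set
Shrinks h b e = ∃ λ h′ → ∃₂ λ b′ e′ → triangular h b e ⇝ triangular h′ b′ e′ × NonZero h′ × (NonZero h → h′ < h)

pivot-shrinks : ∀ {h R e} → ¬ (+ h ∣ R) → Shrinks h R e
pivot-shrinks {h} {R} {e} h∤R =
  let x , y , T⇝T₁ = row-reduce (triangular h R e)
      b′ , e′ , T₁⇝T₂ = column-reduce (matℤ (+ gcd h ℤ.∣ R ∣) 0ℤ x y)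
  in gcd (gcd h ℤ.∣ R ∣) ℤ.∣ x ∣ , b′ , e′ , ⇝-trans T⇝T₁ T₁⇝T₂ , gcd-shrinks h∤R x

pivot-descent : ∀ {h b e} → h ≢ 1 → Primitive (triangular h b e) → Shrinks h b e
pivot-descent h≢1 prim =
  let R , T⇝T₁ , h∤R = nondivisible-upper h≢1 prim
      h′ , b′ , e′ , T₁⇝T₂ , shrunk = pivot-shrinks h∤R
  in h′ , b′ , e′ , ⇝-trans T⇝T₁ T₁⇝T₂ , shrunk

-- The index formula

≡⇒⇔ : ∀ {A B : Set} → A ≡ B → A ⇔ B
≡⇒⇔ refl = mk⇔ id id

∣*⇔/gcd∣ : ∀ {D e v} .{{_ : NonZero (gcd D e)}} → D ℕD.∣ e ℕ.* v ⇔ D / gcd D e ℕD.∣ v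
∣*⇔/gcd∣ {D} {e} {v} = mk⇔ cancel-gcd restore-gcd
  where
  g = gcd D e
  D/g*g≡D : D / g ℕ.* g ≡ D
  D/g*g≡D = m/n*n≡m (ℕG.gcd[m,n]∣m D e)
  ev≡e/g*v*g : e ℕ.* v ≡ e / g ℕ.* v ℕ.* g
  ev≡e/g*v*g = begin
    e ℕ.* v                 ≡⟨ cong (ℕ._* v) (m/n*n≡m (ℕG.gcd[m,n]∣n D e)) ⟨
    e / g ℕ.* g ℕ.* v       ≡⟨ ℕP.*-assoc (e / g) g v ⟩
    e / g ℕ.* (g ℕ.* v)     ≡⟨ cong (e / g ℕ.*_) (ℕP.*-comm g v) ⟩
    e / g ℕ.* (v ℕ.* g)     ≡⟨ ℕP.*-assoc (e / g) v g ⟨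
    e / g ℕ.* v ℕ.* g       ∎
    where open ≡-Reasoning
  cancel-gcd : D ℕD.∣ e ℕ.* v → D / g ℕD.∣ v
  cancel-gcd D∣ev = ℕC.coprime-divisor (ℕC.coprime-/gcd D e)
    (ℕD.*-cancelʳ-∣ g (subst₂ ℕD._∣_ (sym D/g*g≡D) ev≡e/g*v*g D∣ev))
  restore-gcd : D / g ℕD.∣ v → D ℕD.∣ e ℕ.* v
  restore-gcd D/g∣v = subst₂ ℕD._∣_ D/g*g≡D (sym ev≡e/g*v*g) (ℕD.*-monoˡ-∣ g (ℕD.∣n⇒∣m*n (e / g) D/g∣v))

+∣*⇔+/gcd∣ : ∀ {D e v} .{{_ : NonZero (gcd D ℤ.∣ e ∣)}} → + D ∣ e * v ⇔ + (D / gcd D ℤ.∣ e ∣) ∣ v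
+∣*⇔+/gcd∣ {D} {e} {v} = mk⇔
  (∣ᵤ⇒∣ ∘ to ∣*⇔/gcd∣ ∘ subst (D ℕD.∣_) (ℤP.abs-* e v) ∘ ∣⇒∣ᵤ)
  (∣ᵤ⇒∣ ∘ subst (D ℕD.∣_) (sym (ℤP.abs-* e v)) ∘ from ∣*⇔/gcd∣ ∘ ∣⇒∣ᵤ)

indexFormula-diagonal : ∀ e → IndexFormula (matℤ 1ℤ 0ℤ 0ℤ e)
indexFormula-diagonal e D = D ℕ.* (D / g) , IndexIs-resp diagonal⇔ (IndexIs-∣×∣ D (D / g)) , formula
  where
  g = gcd D ℤ.∣ e ∣
  instance
    g≢0 : NonZero g
    g≢0 = ℕ.≢-nonZero (ℕG.gcd[m,n]≢0 D ℤ.∣ e ∣ (inj₁ (ℕ.≢-nonZero⁻¹ D)))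
    D/g≢0 : NonZero (D / g)
    D/g≢0 = ℕ.≢-nonZero (ℕG.m/gcd[m,n]≢0 D ℤ.∣ e ∣)
  first : ∀ u v → 1ℤ * u + 0ℤ * v ≡ u
  first = solve-∀
  second : ∀ e u v → 0ℤ * u + e * v ≡ e * v
  second = solve-∀
  diagonal⇔ : ∀ x → (+ D ∣ proj₁ x × + (D / g) ∣ proj₂ x) ⇔ KerMod (matℤ 1ℤ 0ℤ 0ℤ e) D x
  diagonal⇔ (u , v) = ≡⇒⇔ (cong (+ D ∣_) (sym (first u v)))
                  ×-⇔ (≡⇒⇔ (cong (+ D ∣_) (sym (second e u v))) ⇔-∘ ⇔-sym (+∣*⇔+/gcd∣ {D} {e} {v}))
  det≡e : ∀ e → 1ℤ * e - 0ℤ * 0ℤ ≡ e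
  det≡e = solve-∀
  formula : D ℕ.* (D / g) ℕ.* gcd D ℤ.∣ 1ℤ * e - 0ℤ * 0ℤ ∣ ≡ D ℕ.* D
  formula = begin
    D ℕ.* (D / g) ℕ.* gcd D ℤ.∣ 1ℤ * e - 0ℤ * 0ℤ ∣ ≡⟨ cong (λ δ → D ℕ.* (D / g) ℕ.* gcd D ℤ.∣ δ ∣) (det≡e e) ⟩
    D ℕ.* (D / g) ℕ.* g                            ≡⟨ ℕP.*-assoc D (D / g) g ⟩
    D ℕ.* (D / g ℕ.* g)                            ≡⟨ cong (D ℕ.*_) (m/n*n≡m (ℕG.gcd[m,n]∣m D ℤ.∣ e ∣)) ⟩
    D ℕ.* D                                        ∎
    where open ≡-Reasoning

triangular⇝diagonal : ∀ b e → triangular 1 b e ⇝ matℤ 1ℤ 0ℤ 0ℤ e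
triangular⇝diagonal b e =
  ⇝-trans (⇝-col (triangular 1 b e) (matℤ 1ℤ (- b) 0ℤ 1ℤ) (unit b))
          (⇝-reflexive (matℤ-cong (pivot b) (cleared b) (lower e) (corner b e)))
  where
  unit : ∀ b → 1ℤ * 1ℤ - (- b) * 0ℤ ≡ 1ℤ
  unit = solve-∀
  pivot : ∀ b → 1ℤ * 1ℤ + b * 0ℤ ≡ 1ℤ
  pivot = solve-∀
  cleared : ∀ b → 1ℤ * - b + b * 1ℤ ≡ 0ℤ
  cleared = solve-∀
  lower : ∀ e → 0ℤ * 1ℤ + e * 0ℤ ≡ 0ℤ
  lower = solve-∀
  corner : ∀ b e → 0ℤ * - b + e * 1ℤ ≡ e
  corner = solve-∀

indexFormula-positivePivot : ∀ h → Acc _<_ h → {{_ : NonZero h}} → ∀ {b e} →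
                             Primitive (triangular h b e) → IndexFormula (triangular h b e)
indexFormula-positivePivot h (acc smaller) {{h≢0}} {b} {e} prim = descend (h ℕ.≟ 1)
  where
  descend : Dec (h ≡ 1) → IndexFormula (triangular h b e)
  descend (yes h≡1) = subst (λ h → IndexFormula (triangular h b e)) (sym h≡1)
    (reflects-indexFormula (triangular⇝diagonal b e) (indexFormula-diagonal e))
  descend (no h≢1) =
    let h′ , b′ , e′ , T⇝T′ , h′≢0 , shrunk = pivot-descent {h} {b} {e} h≢1 prim
    in reflects-indexFormula T⇝T′
         (indexFormula-positivePivot h′ (smaller (shrunk h≢0)) {{h′≢0}} {b′} {e′} (preserves-primitive T⇝T′ prim))

indexFormula-triangular : ∀ h {b e} → Primitive (triangular h b e) → IndexFormula (triangular h b e)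
-- A zero pivot is not a measure for the descent; one reduction step makes it positive.
indexFormula-triangular zero {b} {e} prim =
  let h′ , b′ , e′ , T⇝T′ , h′≢0 , _ = pivot-descent {0} {b} {e} (λ ()) prim
  in reflects-indexFormula T⇝T′
       (indexFormula-positivePivot h′ (<-wellFounded h′) {{h′≢0}} {b′} {e′} (preserves-primitive T⇝T′ prim))
indexFormula-triangular h@(suc _) {b} {e} prim = indexFormula-positivePivot h (<-wellFounded h) {b} {e} prim

indexFormula-primitive : ∀ M → Primitive M → IndexFormula M
indexFormula-primitive M prim =
  let b , e , M⇝T = column-reduce M
  in reflects-indexFormula M⇝T
       (indexFormula-triangular (gcd ℤ.∣ Mat2ℤ.a M ∣ ℤ.∣ Mat2ℤ.c M ∣) {b} {e} (preserves-primitive M⇝T prim))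

-- Back to the rational matrix

content≡1⇒primitive : ∀ m₁ m₂ m₃ m₄ → ℤ.∣ ℤG.gcd (ℤG.gcd m₁ m₂) (ℤG.gcd m₃ m₄) ∣ ≡ 1 →
                      Primitive (matℤ m₁ m₂ m₃ m₄)
content≡1⇒primitive m₁ m₂ m₃ m₄ content≡1 z z∣M =
  let z∣m₁ , z∣m₂ , z∣m₃ , z∣m₄ = ∣ᴹ⇒∣-entries {z} {m₁} {m₂} {m₃} {m₄} z∣M
  in ∣ᵤ⇒∣ (subst (ℤ.∣ z ∣ ℕD.∣_) content≡1
       (ℤG.gcd-greatest {ℤG.gcd m₁ m₂} {ℤG.gcd m₃ m₄} {z} (ℤG.gcd-greatest {m₁} {m₂} {z} (∣⇒∣ᵤ z∣m₁) (∣⇒∣ᵤ z∣m₂))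
                                                          (ℤG.gcd-greatest {m₃} {m₄} {z} (∣⇒∣ᵤ z∣m₃) (∣⇒∣ᵤ z∣m₄))))

L⇔KerMod : ∀ f N D m₁ m₂ m₃ m₄ → IsCanonicalForm f N D m₁ m₂ m₃ m₄ →
           ∀ x → L f x ⇔ KerMod (matℤ m₁ m₂ m₃ m₄) D x
L⇔KerMod (mat a b c d) N D m₁ m₂ m₃ m₄ (_ , ℕ.s≤s _ , gcd[N,D]≡1 , _ , Da , Db , Dc , Dd) (u , v) =
  isInt⇔∣ D⊥N (toℚ-scaled-row {D} {N} {a} {b} {m₁} {m₂} Da Db u v) ×-⇔
  isInt⇔∣ D⊥N (toℚ-scaled-row {D} {N} {c} {d} {m₃} {m₄} Dc Dd u v)
  where
  D⊥N : ℕC.Coprime D N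
  D⊥N = ℕC.sym (ℕC.gcd≡1⇒coprime {N} {D} gcd[N,D]≡1)

lemma6p9 : (f : Mat2ℚ) → InGL2 f →
    (N D : ℕ) (m₁ m₂ m₃ m₄ : ℤ) → IsCanonicalForm f N D m₁ m₂ m₃ m₄ →
    (∃ λ k → IndexIs (L f) k) ×
    (∀ k → IndexIs (L f) k →
      (k ℕ.* gcd D ℤ.∣ m₁ ℤ.* m₄ ℤ.- m₂ ℤ.* m₃ ∣ ≡ D ℕ.* D) ×
      (∃ λ (n : ℕ) → toℚ (ℤ.+ k) ℚ.* ℚ.∣ det f ∣ ≡ toℚ (ℤ.+ n)))
-- Invertibility of f is never used: the index formula holds for every primitive M.
lemma6p9 f _ N D m₁ m₂ m₃ m₄ canonical@(_ , ℕ.s≤s _ , _ , content≡1 , _) =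
  (k₀ , IndexIs-resp (⇔-sym ∘ L⇔) index₀) ,
  λ k index → k-formula index ,
              k∣q∣-natural {D ℕ.* D} {k} {det f} {+ (N ℕ.* N) * δ} (toℚ-scaled-det f N D m₁ m₂ m₃ m₄ canonical) (D*D∣ index)
  where
  M = matℤ m₁ m₂ m₃ m₄
  δ = m₁ * m₄ - m₂ * m₃
  L⇔ = L⇔KerMod f N D m₁ m₂ m₃ m₄ canonical
  formula₀ = indexFormula-primitive M (content≡1⇒primitive m₁ m₂ m₃ m₄ content≡1) D
  k₀ = proj₁ formula₀
  index₀ = proj₁ (proj₂ formula₀)
  k-formula : ∀ {k} → IndexIs (L f) k → k ℕ.* gcd D ℤ.∣ δ ∣ ≡ D ℕ.* D
  k-formula index = subst (λ k → k ℕ.* gcd D ℤ.∣ δ ∣ ≡ D ℕ.* D)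
    (IndexIs-unique (KerMod-closed M D) index₀ (IndexIs-resp L⇔ index)) (proj₂ (proj₂ formula₀))
  D*D∣ : ∀ {k} → IndexIs (L f) k → D ℕ.* D ℕD.∣ k ℕ.* ℤ.∣ + (N ℕ.* N) * δ ∣
  D*D∣ {k} index = subst₂ ℕD._∣_ (k-formula index) (cong (k ℕ.*_) (sym (ℤP.abs-* (+ (N ℕ.* N)) δ)))
    (ℕD.*-monoʳ-∣ k (ℕD.∣-trans (ℕG.gcd[m,n]∣n D ℤ.∣ δ ∣) (ℕD.n∣m*n (N ℕ.* N))))
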